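{- For every graph $G$, $$\pi(G^{(3)}) \leq (4+o(1))\, \pi(G)^{2/5},$$ where the $o(1)$ term tends to $0$ as $\pi(G)\to\infty$.
   Context: All graphs are finite, simple and undirected. A path in a graph is a sequence of pairwise distinct vertices, consecutive ones adjacent. Given a vertex colouring $\phi$, a sequence $(v_1,\dots,v_{2s})$ is repetitively coloured if $\phi(v_i)=\phi(v_{s+i})$ for all $i\in\{1,\dots,s\}$; a colouring is nonrepetitive if no path is repetitively coloured. $\pi(G)$ is the minimum number of colours in a nonrepetitive colouring of $G$. $G^{(3)}$ is the $3$-subdivision of $G$, obtained by replacing each edge $vw$ by a path from $v$ to $w$ with exactly three new internal vertices. -}

module Defs where

open import Data.Nat using (ℕ; _<_)
open import Data.Fin using (Fin; toℕ)
open import Data.Bool using (Bool; T; false)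
open import Data.List using (List; []; _∷_; _++_; map)
open import Data.List.Relation.Unary.Unique.Propositional using (Unique)
open import Data.Product using (Σ; _×_; ∃-syntax)
open import Data.Sum using (_⊎_)
open import Relation.Binary.PropositionalEquality using (_≡_; _≢_)
open import Relation.Nullary using (¬_)

-- A finite simple graph on vertex set Fin n (every finite simple graph
-- is isomorphic to one of these).

record FinGraph : Set where
  field
    n      : ℕ
    adj    : Fin n → Fin n → Bool
    sym    : ∀ u w → adj u w ≡ adj w u
    irrefl : ∀ u → adj u u ≡ false

record Graph : Set₁ where
  field
    V   : Set
    _∼_ : V → V → Set

toGraph : FinGraph → Graph
toGraph G = record { V = Fin n ; _∼_ = λ u w → T (adj u w) }
  where open FinGraph G

-- The 3-subdivision G^(3).  Each edge {u,w} with u < w is replaced by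
-- the path  u — near u w — mid u w — near w u — w.

module _ (G : FinGraph) where
  open FinGraph G

  data SubV : Set where
    orig : Fin n → SubV
    near : (u w : Fin n) → .(T (adj u w)) → SubV
    mid  : (u w : Fin n) → .(toℕ u < toℕ w) → .(T (adj u w)) → SubV

  data SubE : SubV → SubV → Set where
    e-end  : (u w : Fin n) .(p : T (adj u w)) → SubE (orig u) (near u w p)
    e-midL : (u w : Fin n) .(lt : toℕ u < toℕ w) .(p : T (adj u w)) .(q : T (adj u w))
           → SubE (near u w q) (mid u w lt p)
    e-midR : (u w : Fin n) .(lt : toℕ u < toℕ w) .(p : T (adj u w)) .(q : T (adj w u))
           → SubE (near w u q) (mid u w lt p)

subdiv3 : FinGraph → Graph
subdiv3 G = record { V = SubV G ; _∼_ = λ x y → SubE G x y ⊎ SubE G y x }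

module _ (G : Graph) where
  open Graph G

  data Consecutive : List V → Set where
    c-nil  : Consecutive []
    c-one  : ∀ x → Consecutive (x ∷ [])
    c-cons : ∀ x y xs → x ∼ y → Consecutive (y ∷ xs) → Consecutive (x ∷ y ∷ xs)

  IsPath : List V → Set
  IsPath xs = Unique xs × Consecutive xs

  -- (v₁,…,v_{2s}), s ≥ 1, with φ(vᵢ) = φ(v_{s+i}):
  -- the list splits as ys ++ zs, ys nonempty, with equal colour sequences.
  Repetitive : {C : Set} → (V → C) → List V → Set
  Repetitive φ xs = Σ (List V) λ ys → Σ (List V) λ zs →
    ys ≢ [] × xs ≡ ys ++ zs × map φ ys ≡ map φ zs

  Nonrepetitive : {k : ℕ} → (V → Fin k) → Set
  Nonrepetitive φ = ∀ xs → IsPath xs → ¬ Repetitive φ xs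

  HasNonrepColouring : ℕ → Set
  HasNonrepColouring k = ∃[ φ ] Nonrepetitive {k} φ

  IsPi : ℕ → Set
  IsPi k = HasNonrepColouring k × (∀ j → j < k → ¬ HasNonrepColouring j)

-- Let φ be a nonrepetitive colouring of G with p ≤ k⁵ colours and encode φ(u) as a triple
-- (a u, b u, c u) ∈ [k²] × [k²] × [k].  Colour G^(3) with 4k² colours: orig u gets a u, the
-- subdivision vertex next to u on an edge uw gets b u (from one of two palettes, according as
-- u < w or u > w), and the middle vertex of uw gets the pair (c u, c w) with u < w.  Along any
-- path of G^(3) the triple of an original vertex can be read off its colour and the colours of
-- the next two vertices (or of the previous two, near the end of the path).  So a repetitively
-- coloured path whose halves have at least four vertices yields a repetitively coloured path of
-- original vertices in G, while shorter repetitions are ruled out by the parity of the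
-- subdivision and by the two neighbours of a subdivision vertex having different colours.
-- Hence π(G^(3)) ≤ 4k², and choosing k with (k - 1)⁵ < p ≤ k⁵ gives the bound.

module Submission where

open import Defs
open import Data.Bool using (Bool; true; false; not; T)
open import Data.Bool.Properties using (T?; ¬-not)
open import Data.Empty using (⊥; ⊥-elim)
open import Data.Fin using (Fin; toℕ; _↑ˡ_; _↑ʳ_; splitAt; combine; remQuot; inject≤)
open import Data.Fin.Properties using (splitAt-↑ˡ; splitAt-↑ʳ; remQuot-combine; combine-remQuot; inject≤-injective)
open import Data.List using (List; []; _∷_; _++_; map; length)
open import Data.List.Properties using (∷-injectiveˡ; ∷-injectiveʳ; length-map; map-∘; map-injective)
open import Data.Maybe using (Maybe; just; nothing)
open import Data.Maybe.Properties using (just-injective)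
open import Data.List.Relation.Unary.All using (All; []; _∷_)
open import Data.List.Relation.Unary.AllPairs using ([]; _∷_)
open import Data.List.Relation.Unary.Unique.Propositional using (Unique)
open import Data.Nat using (ℕ; zero; suc; _+_; _*_; _^_; _≤_; _<_; _≤?_; s≤s; z≤n)
open import Data.Nat.Properties
  using ( _<?_; <-asym; ≮⇒≥; ≤⇒≯; ≰⇒>; <⇒≤pred; ≤-reflexive; ≤-trans; ≤-<-trans; n<1+n; m≤m+n
        ; m≤n⇒m≤1+n; m≤n⇒∃[o]m+o≡n; *-monoʳ-≤; *-mono-≤; ^-monoˡ-≤; ^-monoˡ-<; ^-zeroˡ; ^-identityʳ
        ; module ≤-Reasoning)
open import Data.Nat.Tactic.RingSolver using (solve-∀)
open import Data.Product using (Σ; _×_; _,_; proj₁; proj₂; map₂; uncurry; ∃-syntax)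
open import Data.Sum using (_⊎_; inj₁; inj₂; [_,_]′)
open import Data.Unit using (⊤; tt)
open import Function using (_∘_)
open import Function.Consequences.Propositional using (inverseʳ⇒injective; strictlyInverseʳ⇒inverseʳ)
open import Function.Definitions using (Injective)
open import Relation.Binary.PropositionalEquality
open import Relation.Nullary using (¬_; yes; no)
open import Relation.Nullary.Decidable using (recompute)

module _ (Γ : Graph) where
  open Graph Γ using (V)

  repetitive-∘-injective : ∀ {C D : Set} {f : C → D} → Injective _≡_ _≡_ f →
                           (φ : V → C) (xs : List V) → Repetitive Γ (f ∘ φ) xs → Repetitive Γ φ xs
  repetitive-∘-injective f-injective φ xs (ys , zs , ys≢[] , xs≡ys++zs , same) =
    ys , zs , ys≢[] , xs≡ys++zs , map-injective f-injective (trans (sym (map-∘ ys)) (trans same (map-∘ zs)))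

  π-minimal : ∀ {p q} → IsPi Γ q → HasNonrepColouring Γ p → q ≤ p
  π-minimal (_ , minimal) colouring = ≮⇒≥ (λ p<q → minimal _ p<q colouring)

-- Structure of the 3-subdivision

data Kind : Set where
  original near-lower near-upper middle : Kind

isEven : Kind → Bool
isEven original   = true
isEven near-lower = false
isEven near-upper = false
isEven middle     = true

module Subdivision (G : FinGraph) where
  open FinGraph G using (n; adj)

  V : Set
  V = SubV G

  _~_ : V → V → Set
  _~_ = Graph._∼_ (subdiv3 G)

  ~-sym : ∀ {x y} → x ~ y → y ~ x
  ~-sym (inj₁ e) = inj₂ e
  ~-sym (inj₂ e) = inj₁ e

  private
    edge : ∀ {u w} → .(T (adj u w)) → T (adj u w)
    edge {u} {w} = recompute (T? (adj u w))

    below : ∀ {u w : Fin n} → .(toℕ u < toℕ w) → toℕ u < toℕ w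
    below {u} {w} = recompute (toℕ u <? toℕ w)

  IsOrig : V → Set
  IsOrig (orig _) = ⊤
  IsOrig _        = ⊥

  kind : V → Kind
  kind (orig _) = original
  kind (near u w _) with toℕ u <? toℕ w
  ... | yes _ = near-lower
  ... | no  _ = near-upper
  kind (mid _ _ _ _) = middle

  kind-near-< : ∀ {u w} .{q} → toℕ u < toℕ w → kind (near u w q) ≡ near-lower
  kind-near-< {u} {w} u<w with toℕ u <? toℕ w
  ... | yes _  = refl
  ... | no u≮w = ⊥-elim (u≮w u<w)

  kind-near-> : ∀ {u w} .{q} → toℕ w < toℕ u → kind (near u w q) ≡ near-upper
  kind-near-> {u} {w} w<u with toℕ u <? toℕ w
  ... | yes u<w = ⊥-elim (<-asym u<w w<u)
  ... | no _    = refl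

  near-kinds-differ : ∀ {u w} .{q q′} → toℕ u < toℕ w → kind (near u w q) ≢ kind (near w u q′)
  near-kinds-differ u<w same with () ← trans (sym (kind-near-< u<w)) (trans same (kind-near-> u<w))

  near-odd : ∀ u w .{q} → isEven (kind (near u w q)) ≡ false
  near-odd u w with toℕ u <? toℕ w
  ... | yes _ = refl
  ... | no  _ = refl

  edge-parity : ∀ {x y} → SubE G x y → isEven (kind x) ≢ isEven (kind y)
  edge-parity (e-end u w p) rewrite near-odd u w {p} = λ ()
  edge-parity (e-midL u w _ _ q) rewrite near-odd u w {q} = λ ()
  edge-parity (e-midR u w _ _ q) rewrite near-odd w u {q} = λ ()

  ~-parity : ∀ {x y} → x ~ y → isEven (kind x) ≢ isEven (kind y)
  ~-parity (inj₁ e) = edge-parity e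
  ~-parity (inj₂ e) = edge-parity e ∘ sym

  -- The middle vertex of the edge {u, w} exists only as mid u w with u < w; MidOf forgets the orientation.
  data MidOf (u w : Fin n) : V → Set where
    lower : (u<w : toℕ u < toℕ w) (p : T (adj u w)) → MidOf u w (mid u w u<w p)
    upper : (w<u : toℕ w < toℕ u) (p : T (adj w u)) → MidOf u w (mid w u w<u p)

  MidOf-sym : ∀ {u w x} → MidOf u w x → MidOf w u x
  MidOf-sym (lower u<w p) = upper u<w p
  MidOf-sym (upper w<u p) = lower w<u p

  MidOf-kind : ∀ {u w x} → MidOf u w x → kind x ≡ middle
  MidOf-kind (lower _ _) = refl
  MidOf-kind (upper _ _) = refl

  MidOf-unique : ∀ {u w x y} → MidOf u w x → MidOf u w y → x ≡ y
  MidOf-unique (lower _ _)   (lower _ _)   = refl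
  MidOf-unique (lower u<w _) (upper w<u _) = ⊥-elim (<-asym u<w w<u)
  MidOf-unique (upper w<u _) (lower u<w _) = ⊥-elim (<-asym u<w w<u)
  MidOf-unique (upper _ _)   (upper _ _)   = refl

  orig-neighbour : ∀ {u x} → orig u ~ x → ∃[ w ] Σ (T (adj u w)) λ p → x ≡ near u w p
  orig-neighbour (inj₁ (e-end u w p)) = w , edge p , refl

  data NearNeighbour (u w : Fin n) : V → Set where
    endpoint : NearNeighbour u w (orig u)
    midpoint : ∀ {x} → MidOf u w x → NearNeighbour u w x

  near-neighbour : ∀ {u w x} .{q} → near u w q ~ x → NearNeighbour u w x
  near-neighbour (inj₁ (e-midL u w u<w p _)) = midpoint (lower (below u<w) (edge p))
  near-neighbour (inj₁ (e-midR w u w<u p _)) = midpoint (upper (below w<u) (edge p))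
  near-neighbour (inj₂ (e-end u w p))        = endpoint

  data MidNeighbour (u w : Fin n) : V → Set where
    nearˡ : (q : T (adj u w)) → MidNeighbour u w (near u w q)
    nearʳ : (q : T (adj w u)) → MidNeighbour u w (near w u q)

  mid-neighbour : ∀ {u w x y} → MidOf u w x → x ~ y → MidNeighbour u w y
  mid-neighbour (lower _ _) (inj₂ (e-midL u w _ _ q)) = nearˡ (edge q)
  mid-neighbour (lower _ _) (inj₂ (e-midR u w _ _ q)) = nearʳ (edge q)
  mid-neighbour (upper _ _) (inj₂ (e-midL w u _ _ q)) = nearʳ (edge q)
  mid-neighbour (upper _ _) (inj₂ (e-midR w u _ _ q)) = nearˡ (edge q)

  orig-neighbour-not-orig : ∀ {u x} → orig u ~ x → ¬ IsOrig x
  orig-neighbour-not-orig e with orig-neighbour e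
  ... | _ , _ , refl = λ ()

  near-neighbours-distinct : ∀ {u w x y} .{q} → near u w q ~ x → near u w q ~ y → x ≢ y →
                             IsOrig x ⊎ IsOrig y
  near-neighbours-distinct e f x≢y with near-neighbour e | near-neighbour f
  ... | endpoint   | _          = inj₁ tt
  ... | midpoint _ | endpoint   = inj₂ tt
  ... | midpoint m | midpoint m′ = ⊥-elim (x≢y (MidOf-unique m m′))

  neighbour-by-kind : ∀ {y x x′} → ¬ IsOrig y → y ~ x → y ~ x′ → kind x ≡ kind x′ → x ≡ x′
  neighbour-by-kind {orig _} ¬orig _ _ _ = ⊥-elim (¬orig tt)
  neighbour-by-kind {near _ _ _} _ e e′ same with near-neighbour e | near-neighbour e′
  ... | endpoint   | endpoint   = refl
  ... | midpoint m | midpoint m′ = MidOf-unique m m′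
  ... | endpoint   | midpoint m  with () ← trans same (MidOf-kind m)
  ... | midpoint m | endpoint    with () ← trans (sym same) (MidOf-kind m)
  neighbour-by-kind {mid u w u<w p} _ e e′ same
    with mid-neighbour (lower (below u<w) (edge p)) e | mid-neighbour (lower (below u<w) (edge p)) e′
  ... | nearˡ _ | nearˡ _ = refl
  ... | nearʳ _ | nearʳ _ = refl
  ... | nearˡ _ | nearʳ _ = ⊥-elim (near-kinds-differ (below u<w) same)
  ... | nearʳ _ | nearˡ _ = ⊥-elim (near-kinds-differ (below u<w) (sym same))

  Walk : List V → Set
  Walk = Consecutive (subdiv3 G)

  NoBacktrack : List V → Set
  NoBacktrack (x ∷ y ∷ z ∷ r) = x ≢ z × NoBacktrack (y ∷ z ∷ r)
  NoBacktrack _               = ⊤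

  NBWalk : List V → Set
  NBWalk xs = Walk xs × NoBacktrack xs

  path⇒NBWalk : ∀ {xs} → IsPath (subdiv3 G) xs → NBWalk xs
  path⇒NBWalk {xs} (unique , walk) = walk , no-backtrack xs unique
    where
    no-backtrack : ∀ xs → Unique xs → NoBacktrack xs
    no-backtrack (x ∷ y ∷ z ∷ r) ((_ ∷ x≢z ∷ _) ∷ unique) = x≢z , no-backtrack (y ∷ z ∷ r) unique
    no-backtrack []              _ = tt
    no-backtrack (_ ∷ [])        _ = tt
    no-backtrack (_ ∷ _ ∷ [])    _ = tt

  NBWalk-tail : ∀ {x xs} → NBWalk (x ∷ xs) → NBWalk xs
  NBWalk-tail {xs = []}        _                          = c-nil , tt
  NBWalk-tail {xs = _ ∷ []}    (c-cons _ _ _ _ walk , _)  = walk , tt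
  NBWalk-tail {xs = _ ∷ _ ∷ _} (c-cons _ _ _ _ walk , _ , nb) = walk , nb

  NBWalk-suffix : ∀ xs {ys} → NBWalk (xs ++ ys) → NBWalk ys
  NBWalk-suffix []       l = l
  NBWalk-suffix (_ ∷ xs) l = NBWalk-suffix xs (NBWalk-tail l)

  NBWalk-prefix : ∀ xs ys → NBWalk (xs ++ ys) → NBWalk xs
  NBWalk-prefix xs ys (walk , nb) = walk-prefix xs walk , nb-prefix xs nb
    where
    walk-prefix : ∀ xs → Walk (xs ++ ys) → Walk xs
    walk-prefix []          _                       = c-nil
    walk-prefix (x ∷ [])    _                       = c-one x
    walk-prefix (x ∷ y ∷ r) (c-cons _ _ _ e walk)   = c-cons x y r e (walk-prefix (y ∷ r) walk)

    nb-prefix : ∀ xs → NoBacktrack (xs ++ ys) → NoBacktrack xs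
    nb-prefix (x ∷ y ∷ z ∷ r) (x≢z , nb) = x≢z , nb-prefix (y ∷ z ∷ r) nb
    nb-prefix []              _ = tt
    nb-prefix (_ ∷ [])        _ = tt
    nb-prefix (_ ∷ _ ∷ [])    _ = tt

  originals : List V → List (Fin n)
  originals []                  = []
  originals (orig u ∷ xs)       = u ∷ originals xs
  originals (near _ _ _ ∷ xs)   = originals xs
  originals (mid _ _ _ _ ∷ xs)  = originals xs

  originals-++ : ∀ xs ys → originals (xs ++ ys) ≡ originals xs ++ originals ys
  originals-++ []                 ys = refl
  originals-++ (orig u ∷ xs)      ys = cong (u ∷_) (originals-++ xs ys)
  originals-++ (near _ _ _ ∷ xs)  ys = originals-++ xs ys
  originals-++ (mid _ _ _ _ ∷ xs) ys = originals-++ xs ys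

  originals-unique : ∀ xs → Unique xs → Unique (originals xs)
  originals-unique []                 _              = []
  originals-unique (orig u ∷ xs)      (u∉xs ∷ uniq)  = all-originals xs u∉xs ∷ originals-unique xs uniq
    where
    all-originals : ∀ xs → All (orig u ≢_) xs → All (u ≢_) (originals xs)
    all-originals []                 []         = []
    all-originals (orig _ ∷ xs)      (p ∷ ps)   = (p ∘ cong orig) ∷ all-originals xs ps
    all-originals (near _ _ _ ∷ xs)  (_ ∷ ps)   = all-originals xs ps
    all-originals (mid _ _ _ _ ∷ xs) (_ ∷ ps)   = all-originals xs ps
  originals-unique (near _ _ _ ∷ xs)  (_ ∷ uniq) = originals-unique xs uniq
  originals-unique (mid _ _ _ _ ∷ xs) (_ ∷ uniq) = originals-unique xs uniq

  originals-≡[] : ∀ x xs → originals (x ∷ xs) ≡ [] → ¬ IsOrig x × originals xs ≡ []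
  originals-≡[] (orig _)      _ ()
  originals-≡[] (near _ _ _)  _ none = (λ ()) , none
  originals-≡[] (mid _ _ _ _) _ none = (λ ()) , none

  -- Original vertices are at distance 4 in G^(3), so a no-backtracking walk cannot avoid them for four steps.
  four-steps-meet-original : ∀ x₁ x₂ x₃ x₄ r → NBWalk (x₁ ∷ x₂ ∷ x₃ ∷ x₄ ∷ r) →
                             ¬ IsOrig x₁ → ¬ IsOrig x₂ → ¬ IsOrig x₃ → ¬ IsOrig x₄ → ⊥
  four-steps-meet-original x₁ (orig _) x₃ x₄ r _ _ ¬o₂ _ _ = ¬o₂ tt
  four-steps-meet-original x₁ (near _ _ _) x₃ x₄ r
    (c-cons _ _ _ e₁₂ (c-cons _ _ _ e₂₃ _) , x₁≢x₃ , _) ¬o₁ _ ¬o₃ _ =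
    [ ¬o₁ , ¬o₃ ]′ (near-neighbours-distinct (~-sym e₁₂) e₂₃ x₁≢x₃)
  four-steps-meet-original x₁ (mid u w u<w p) x₃ x₄ r
    (c-cons _ _ _ _ (c-cons _ _ _ e₂₃ (c-cons _ _ _ e₃₄ _)) , _ , x₂≢x₄ , _) _ _ _ ¬o₄
    with mid-neighbour (lower (below u<w) (edge p)) e₂₃
  ... | nearˡ _ = [ (λ ()) , ¬o₄ ]′ (near-neighbours-distinct (~-sym e₂₃) e₃₄ x₂≢x₄)
  ... | nearʳ _ = [ (λ ()) , ¬o₄ ]′ (near-neighbours-distinct (~-sym e₂₃) e₃₄ x₂≢x₄)

  originals-nonempty : ∀ x₁ x₂ x₃ x₄ r → NBWalk (x₁ ∷ x₂ ∷ x₃ ∷ x₄ ∷ r) →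
                       originals (x₁ ∷ x₂ ∷ x₃ ∷ x₄ ∷ r) ≢ []
  originals-nonempty x₁ x₂ x₃ x₄ r l none
    with originals-≡[] x₁ _ none
  ... | ¬o₁ , none₁ with originals-≡[] x₂ _ none₁
  ... | ¬o₂ , none₂ with originals-≡[] x₃ _ none₂
  ... | ¬o₃ , none₃ with originals-≡[] x₄ _ none₃
  ... | ¬o₄ , _ = four-steps-meet-original x₁ x₂ x₃ x₄ r l ¬o₁ ¬o₂ ¬o₃ ¬o₄

  GWalk : List (Fin n) → Set
  GWalk = Consecutive (toGraph G)

  AdjacentToHead : Fin n → List (Fin n) → Set
  AdjacentToHead u []      = ⊤
  AdjacentToHead u (w ∷ _) = T (adj u w)

  GWalk-∷ : ∀ {u ws} → AdjacentToHead u ws → GWalk ws → GWalk (u ∷ ws)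
  GWalk-∷ {u} {[]}     _     _    = c-one u
  GWalk-∷ {u} {w ∷ ws} u~w walk = c-cons u w ws u~w walk

  -- Leaving orig u, a no-backtracking walk must run along a whole subdivided edge
  -- orig u, near u w, mid, near w u, orig w.
  from-far-near : ∀ {u w x} .{q} r → MidOf u w x → T (adj u w) →
                  NBWalk (x ∷ near w u q ∷ r) → AdjacentToHead u (originals r)
  from-far-near []      _ _   _ = tt
  from-far-near (y ∷ r) m u~w (c-cons _ _ _ _ (c-cons _ _ _ e _) , x≢y , _) with near-neighbour e
  ... | endpoint    = u~w
  ... | midpoint m′ = ⊥-elim (x≢y (MidOf-unique m (MidOf-sym m′)))

  from-mid : ∀ {u w x} .{p} r → MidOf u w x → T (adj u w) →
             NBWalk (near u w p ∷ x ∷ r) → AdjacentToHead u (originals r)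
  from-mid []      _ _   _ = tt
  from-mid (y ∷ r) m u~w (c-cons _ _ _ _ walk@(c-cons _ _ _ e _) , near≢y , nb) with mid-neighbour m e
  ... | nearˡ _ = ⊥-elim (near≢y refl)
  ... | nearʳ _ = from-far-near r m u~w (walk , nb)

  from-near : ∀ {u w} r (p : T (adj u w)) → NBWalk (orig u ∷ near u w p ∷ r) → AdjacentToHead u (originals r)
  from-near []      _ _ = tt
  from-near (x ∷ r) p (c-cons _ _ _ _ walk@(c-cons _ _ _ e _) , u≢x , nb) with near-neighbour e
  ... | endpoint            = ⊥-elim (u≢x refl)
  ... | midpoint m@(lower _ _) = from-mid r m p (walk , nb)
  ... | midpoint m@(upper _ _) = from-mid r m p (walk , nb)

  from-original : ∀ u r → NBWalk (orig u ∷ r) → AdjacentToHead u (originals r)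
  from-original u []      _ = tt
  from-original u (x ∷ r) l@(c-cons _ _ _ e _ , _) with orig-neighbour e
  ... | _ , p , refl = from-near r p l

  originals-walk : ∀ xs → NBWalk xs → GWalk (originals xs)
  originals-walk []                  _ = c-nil
  originals-walk (orig u ∷ xs)       l = GWalk-∷ (from-original u xs l) (originals-walk xs (NBWalk-tail l))
  originals-walk (near _ _ _ ∷ xs)   l = originals-walk xs (NBWalk-tail l)
  originals-walk (mid _ _ _ _ ∷ xs)  l = originals-walk xs (NBWalk-tail l)

  originals-path : ∀ {xs} → IsPath (subdiv3 G) xs → IsPath (toGraph G) (originals xs)
  originals-path {xs} path@(unique , _) = originals-unique xs unique , originals-walk xs (path⇒NBWalk path)

-- The colouring of the 3-subdivision

data Colour (A C : Set) : Set where
  O     : A → Colour A C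
  N₁ N₂ : A → Colour A C
  M     : C → C → Colour A C

colourKind : ∀ {A C} → Colour A C → Kind
colourKind (O _)   = original
colourKind (N₁ _)  = near-lower
colourKind (N₂ _)  = near-upper
colourKind (M _ _) = middle

data Behind (X : Set) : Set where
  none : Behind X
  one  : X → Behind X
  two  : X → X → Behind X

push : ∀ {X} → Behind X → X → Behind X
push none      x = one x
push (one y)   x = two y x
push (two _ y) x = two y x

mapBehind : ∀ {X Y : Set} → (X → Y) → Behind X → Behind Y
mapBehind f none      = none
mapBehind f (one x)   = one (f x)
mapBehind f (two x y) = two (f x) (f y)

mapBehind-push : ∀ {X Y : Set} (f : X → Y) β x → mapBehind f (push β x) ≡ push (mapBehind f β) (f x)
mapBehind-push f none      x = refl
mapBehind-push f (one _)   x = refl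
mapBehind-push f (two _ _) x = refl

behind : ∀ {X} → Behind X → List X
behind none      = []
behind (one x)   = x ∷ []
behind (two x y) = x ∷ y ∷ []

-- Four vertices in all, or two already passed: then every original vertex has two path-neighbours on one side.
Sufficient : ∀ {X} → Behind X → ℕ → Set
Sufficient none      l = 4 ≤ l
Sufficient (one _)   l = 3 ≤ l
Sufficient (two _ _) l = ⊤

Sufficient-push : ∀ {X} (β : Behind X) x l → Sufficient β (suc l) → Sufficient (push β x) l
Sufficient-push none      _ _ (s≤s s) = s
Sufficient-push (one _)   _ _ _       = tt
Sufficient-push (two _ _) _ _ _       = tt

module Decoding {A C : Set} where

  decodeAt : A → Colour A C → Colour A C → Maybe (A × A × C)
  decodeAt x (N₁ y) (M c _) = just (x , y , c)
  decodeAt x (N₂ y) (M _ c) = just (x , y , c)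
  decodeAt _ _      _       = nothing

  decodeOriginal : Behind (Colour A C) → A → List (Colour A C) → Maybe (A × A × C)
  decodeOriginal _         x (y ∷ z ∷ _) = decodeAt x y z
  decodeOriginal (two z y) x []          = decodeAt x y z
  decodeOriginal (two z y) x (_ ∷ [])    = decodeAt x y z
  decodeOriginal _         _ _           = nothing

  decode : Behind (Colour A C) → List (Colour A C) → List (Maybe (A × A × C))
  decode _ []           = []
  decode b (O x ∷ cs)   = decodeOriginal b x cs ∷ decode (push b (O x)) cs
  decode b (N₁ y ∷ cs)  = decode (push b (N₁ y)) cs
  decode b (N₂ y ∷ cs)  = decode (push b (N₂ y)) cs
  decode b (M c d ∷ cs) = decode (push b (M c d)) cs

module Colouring (G : FinGraph) {A C : Set} (τ : Fin (FinGraph.n G) → A × A × C) where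
  open FinGraph G using (n; adj)
  open Subdivision G
  open Decoding

  private
    a b : Fin n → A
    a u = proj₁ (τ u)
    b u = proj₁ (proj₂ (τ u))

    c : Fin n → C
    c u = proj₂ (proj₂ (τ u))

  colour : V → Colour A C
  colour (orig u) = O (a u)
  colour (near u w _) with toℕ u <? toℕ w
  ... | yes _ = N₁ (b u)
  ... | no  _ = N₂ (b u)
  colour (mid u w _ _) = M (c u) (c w)

  colourKind-colour : ∀ x → colourKind (colour x) ≡ kind x
  colourKind-colour (orig _) = refl
  colourKind-colour (near u w _) with toℕ u <? toℕ w
  ... | yes _ = refl
  ... | no  _ = refl
  colourKind-colour (mid _ _ _ _) = refl

  colour-near-< : ∀ {u w} .{q} → toℕ u < toℕ w → colour (near u w q) ≡ N₁ (b u)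
  colour-near-< {u} {w} u<w with toℕ u <? toℕ w
  ... | yes _  = refl
  ... | no u≮w = ⊥-elim (u≮w u<w)

  colour-near-> : ∀ {u w} .{q} → toℕ w < toℕ u → colour (near u w q) ≡ N₂ (b u)
  colour-near-> {u} {w} w<u with toℕ u <? toℕ w
  ... | yes u<w = ⊥-elim (<-asym u<w w<u)
  ... | no _    = refl

  same-colour⇒same-kind : ∀ {x y} → colour x ≡ colour y → kind x ≡ kind y
  same-colour⇒same-kind {x} {y} same =
    trans (sym (colourKind-colour x)) (trans (cong colourKind same) (colourKind-colour y))

  adjacent-colours-differ : ∀ {x y} → x ~ y → colour x ≢ colour y
  adjacent-colours-differ {x} {y} x~y = ~-parity x~y ∘ cong isEven ∘ same-colour⇒same-kind {x} {y}

  decodeAt-colour : ∀ {u y z} → orig u ~ y → y ~ z → z ≢ orig u →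
                    decodeAt (a u) (colour y) (colour z) ≡ just (τ u)
  decodeAt-colour {u} u~y y~z z≢u with orig-neighbour u~y
  ... | w , p , refl with near-neighbour y~z
  ... | endpoint = ⊥-elim (z≢u refl)
  ... | midpoint (lower u<w _) rewrite colour-near-< {q = p} u<w = refl
  ... | midpoint (upper w<u _) rewrite colour-near-> {q = p} w<u = refl

  decode-near : ∀ {u w} .{q} β cs →
                decode β (colour (near u w q) ∷ cs) ≡ decode (push β (colour (near u w q))) cs
  decode-near {u} {w} β cs with toℕ u <? toℕ w
  ... | yes _ = refl
  ... | no  _ = refl

  decodeOriginal-colour : ∀ β u r → NBWalk (behind β ++ orig u ∷ r) → Sufficient β (suc (length r)) →
                          decodeOriginal (mapBehind colour β) (a u) (map colour r) ≡ just (τ u)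
  decodeOriginal-colour β u (y ∷ z ∷ r) l _ with NBWalk-suffix (behind β) {orig u ∷ y ∷ z ∷ r} l
  ... | c-cons _ _ _ u~y (c-cons _ _ _ y~z _) , u≢z , _ = decodeAt-colour u~y y~z (u≢z ∘ sym)
  decodeOriginal-colour (two _ _) u [] (c-cons _ _ _ e₂₁ (c-cons _ _ _ e₁u _) , v₂≢u , _) _ =
    decodeAt-colour (~-sym e₁u) (~-sym e₂₁) v₂≢u
  decodeOriginal-colour (two _ _) u (_ ∷ []) (c-cons _ _ _ e₂₁ (c-cons _ _ _ e₁u _) , v₂≢u , _) _ =
    decodeAt-colour (~-sym e₁u) (~-sym e₂₁) v₂≢u
  decodeOriginal-colour none    _ []       _ (s≤s ())
  decodeOriginal-colour (one _) _ []       _ (s≤s ())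
  decodeOriginal-colour none    _ (_ ∷ []) _ (s≤s (s≤s ()))
  decodeOriginal-colour (one _) _ (_ ∷ []) _ (s≤s (s≤s ()))

  NBWalk-push : ∀ β x xs → NBWalk (behind β ++ x ∷ xs) → NBWalk (behind (push β x) ++ xs)
  NBWalk-push none      _ _ l = l
  NBWalk-push (one _)   _ _ l = l
  NBWalk-push (two _ _) _ _ l = NBWalk-tail l

  decode-colour : ∀ β xs → NBWalk (behind β ++ xs) → Sufficient β (length xs) →
                  decode (mapBehind colour β) (map colour xs) ≡ map (just ∘ τ) (originals xs)
  decode-colour-push : ∀ β x xs → NBWalk (behind β ++ x ∷ xs) → Sufficient β (suc (length xs)) →
                       decode (push (mapBehind colour β) (colour x)) (map colour xs) ≡ map (just ∘ τ) (originals xs)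

  decode-colour β []                 _ _ = refl
  decode-colour β (orig u ∷ xs)      l s =
    cong₂ _∷_ (decodeOriginal-colour β u xs l s) (decode-colour-push β _ xs l s)
  decode-colour β (near _ _ q ∷ xs)  l s =
    trans (decode-near {q = q} (mapBehind colour β) (map colour xs)) (decode-colour-push β _ xs l s)
  decode-colour β (mid _ _ _ _ ∷ xs) l s = decode-colour-push β _ xs l s

  decode-colour-push β x xs l s =
    trans (cong (λ β′ → decode β′ (map colour xs)) (sym (mapBehind-push colour β x)))
          (decode-colour (push β x) xs (NBWalk-push β x xs l) (Sufficient-push β x (length xs) s))

  colours-differ-at-distance-3 : ∀ {y₁ y₂ y₃ z} → y₁ ~ y₂ → y₂ ~ y₃ → y₃ ~ z → colour y₁ ≢ colour z
  colours-differ-at-distance-3 {y₁} {y₂} {y₃} {z} e₁ e₂ e₃ same = ~-parity e₃ (begin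
    isEven (kind y₃)        ≡⟨ ¬-not (~-parity (~-sym e₂)) ⟩
    not (isEven (kind y₂))  ≡⟨ sym (¬-not (~-parity e₁)) ⟩
    isEven (kind y₁)        ≡⟨ cong isEven (same-colour⇒same-kind {y₁} {z} same) ⟩
    isEven (kind z)         ∎)
    where open ≡-Reasoning

  -- The middle one of y₂, z₁ is not original, and its two neighbours of a given colour coincide.
  no-repetition-of-period-2 : ∀ {y₁ y₂ z₁ z₂} → y₁ ~ y₂ → y₂ ~ z₁ → z₁ ~ z₂ → y₁ ≢ z₁ → y₂ ≢ z₂ →
                     colour y₁ ≡ colour z₁ → colour y₂ ≡ colour z₂ → ⊥
  no-repetition-of-period-2 {y₁} {z₁ = z₁@(orig _)} e₁ e₂ _ y₁≢z₁ _ same₁ _ =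
    y₁≢z₁ (neighbour-by-kind (orig-neighbour-not-orig (~-sym e₂)) (~-sym e₁) e₂
                             (same-colour⇒same-kind {y₁} {z₁} same₁))
  no-repetition-of-period-2 {y₂ = y₂} {z₁ = near _ _ _} {z₂} _ e₂ e₃ _ y₂≢z₂ _ same₂ =
    y₂≢z₂ (neighbour-by-kind (λ ()) (~-sym e₂) e₃ (same-colour⇒same-kind {y₂} {z₂} same₂))
  no-repetition-of-period-2 {y₂ = y₂} {z₁ = mid _ _ _ _} {z₂} _ e₂ e₃ _ y₂≢z₂ _ same₂ =
    y₂≢z₂ (neighbour-by-kind (λ ()) (~-sym e₂) e₃ (same-colour⇒same-kind {y₂} {z₂} same₂))

  repetition-descends-to-originals : ∀ ys zs → IsPath (subdiv3 G) (ys ++ zs) → ys ≢ [] →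
                                     map colour ys ≡ map colour zs →
                  originals ys ≢ [] × map τ (originals ys) ≡ map τ (originals zs)
  repetition-descends-to-originals [] _ _ ys≢[] _ = ⊥-elim (ys≢[] refl)
  repetition-descends-to-originals (_ ∷ []) [] _ _ ()
  repetition-descends-to-originals (_ ∷ []) (_ ∷ _) (_ , c-cons _ _ _ e₁ _) _ same =
    ⊥-elim (adjacent-colours-differ e₁ (∷-injectiveˡ same))
  repetition-descends-to-originals (_ ∷ _ ∷ []) [] _ _ ()
  repetition-descends-to-originals (_ ∷ _ ∷ []) (_ ∷ []) _ _ ()
  repetition-descends-to-originals (_ ∷ _ ∷ []) (_ ∷ _ ∷ _)
    ((_ ∷ y₁≢z₁ ∷ _) ∷ (_ ∷ y₂≢z₂ ∷ _) ∷ _ , c-cons _ _ _ e₁ (c-cons _ _ _ e₂ (c-cons _ _ _ e₃ _))) _ same =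
    ⊥-elim (no-repetition-of-period-2 e₁ e₂ e₃ y₁≢z₁ y₂≢z₂
                                      (∷-injectiveˡ same) (∷-injectiveˡ (∷-injectiveʳ same)))
  repetition-descends-to-originals (_ ∷ _ ∷ _ ∷ []) [] _ _ ()
  repetition-descends-to-originals (_ ∷ _ ∷ _ ∷ []) (_ ∷ _)
    (_ , c-cons _ _ _ e₁ (c-cons _ _ _ e₂ (c-cons _ _ _ e₃ _))) _ same =
    ⊥-elim (colours-differ-at-distance-3 e₁ e₂ e₃ (∷-injectiveˡ same))
  repetition-descends-to-originals ys@(y₁ ∷ y₂ ∷ y₃ ∷ y₄ ∷ r) zs path _ same =
    originals-nonempty y₁ y₂ y₃ y₄ r ys-walk , map-injective just-injective decoded
    where
    walk : NBWalk (ys ++ zs)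
    walk = path⇒NBWalk path

    ys-walk : NBWalk ys
    ys-walk = NBWalk-prefix ys zs walk

    zs-long : 4 ≤ length zs
    zs-long = subst (4 ≤_) (trans (sym (length-map colour ys)) (trans (cong length same) (length-map colour zs)))
                    (s≤s (s≤s (s≤s (s≤s z≤n))))

    decoded : map just (map τ (originals ys)) ≡ map just (map τ (originals zs))
    decoded = begin
      map just (map τ (originals ys))  ≡⟨ map-∘ (originals ys) ⟨
      map (just ∘ τ) (originals ys)    ≡⟨ decode-colour none ys ys-walk (s≤s (s≤s (s≤s (s≤s z≤n)))) ⟨
      decode none (map colour ys)      ≡⟨ cong (decode none) same ⟩
      decode none (map colour zs)      ≡⟨ decode-colour none zs (NBWalk-suffix ys walk) zs-long ⟩
      map (just ∘ τ) (originals zs)    ≡⟨ map-∘ (originals zs) ⟩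
      map just (map τ (originals zs))  ∎
      where open ≡-Reasoning

  colour-nonrepetitive : (∀ us → IsPath (toGraph G) us → ¬ Repetitive (toGraph G) τ us) →
                         ∀ xs → IsPath (subdiv3 G) xs → ¬ Repetitive (subdiv3 G) colour xs
  colour-nonrepetitive τ-nonrep xs path (ys , zs , ys≢[] , refl , same)
    with repetition-descends-to-originals ys zs path ys≢[] same
  ... | nonempty , τ-same = τ-nonrep (originals xs) (originals-path path)
                              (originals ys , originals zs , nonempty , originals-++ ys zs , τ-same)

-- Counting colours

module _ {m k : ℕ} where

  colourIndex : Colour (Fin m) (Fin k) → Fin (m + (m + (m + k * k)))
  colourIndex (O x)   = x ↑ˡ (m + (m + k * k))
  colourIndex (N₁ x)  = m ↑ʳ (x ↑ˡ (m + k * k))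
  colourIndex (N₂ x)  = m ↑ʳ (m ↑ʳ (x ↑ˡ (k * k)))
  colourIndex (M c d) = m ↑ʳ (m ↑ʳ (m ↑ʳ combine c d))

  indexColour : Fin (m + (m + (m + k * k))) → Colour (Fin m) (Fin k)
  indexColour i with splitAt m i
  ... | inj₁ x = O x
  ... | inj₂ i with splitAt m i
  ... | inj₁ x = N₁ x
  ... | inj₂ i with splitAt m i
  ... | inj₁ x = N₂ x
  ... | inj₂ i = uncurry M (remQuot k i)

  indexColour-colourIndex : ∀ c → indexColour (colourIndex c) ≡ c
  indexColour-colourIndex (O x)
    rewrite splitAt-↑ˡ m x (m + (m + k * k)) = refl
  indexColour-colourIndex (N₁ x)
    rewrite splitAt-↑ʳ m (m + (m + k * k)) (x ↑ˡ (m + k * k)) | splitAt-↑ˡ m x (m + k * k) = refl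
  indexColour-colourIndex (N₂ x)
    rewrite splitAt-↑ʳ m (m + (m + k * k)) (m ↑ʳ (x ↑ˡ (k * k))) | splitAt-↑ʳ m (m + k * k) (x ↑ˡ (k * k))
          | splitAt-↑ˡ m x (k * k) = refl
  indexColour-colourIndex (M c d)
    rewrite splitAt-↑ʳ m (m + (m + k * k)) (m ↑ʳ (m ↑ʳ combine c d))
          | splitAt-↑ʳ m (m + k * k) (m ↑ʳ combine c d)
          | splitAt-↑ʳ m (k * k) (combine c d) = cong (uncurry M) (remQuot-combine c d)

  colourIndex-injective : Injective _≡_ _≡_ colourIndex
  colourIndex-injective =
    inverseʳ⇒injective colourIndex
      (strictlyInverseʳ⇒inverseʳ {f⁻¹ = indexColour} colourIndex indexColour-colourIndex)

  tripleOf : Fin (m * (m * k)) → Fin m × Fin m × Fin k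
  tripleOf i = map₂ (remQuot k) (remQuot (m * k) i)

  tripleOf-injective : Injective _≡_ _≡_ tripleOf
  tripleOf-injective =
    inverseʳ⇒injective tripleOf
      (strictlyInverseʳ⇒inverseʳ {f⁻¹ = combineTriple} tripleOf combine-tripleOf)
    where
    combineTriple : Fin m × Fin m × Fin k → Fin (m * (m * k))
    combineTriple (x , y , z) = combine x (combine y z)

    combine-tripleOf : ∀ i → combineTriple (tripleOf i) ≡ i
    combine-tripleOf i = trans (cong (combine {m} x) (combine-remQuot {m} k yz)) (combine-remQuot {m} (m * k) i)
      where
      x : Fin m
      x = proj₁ (remQuot {m} (m * k) i)

      yz : Fin (m * k)
      yz = proj₂ (remQuot {m} (m * k) i)

subdivision-colouring : ∀ G {p m k} → HasNonrepColouring (toGraph G) p → p ≤ m * (m * k) →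
                        HasNonrepColouring (subdiv3 G) (m + (m + (m + k * k)))
subdivision-colouring G {p} {m} {k} (φ , φ-nonrep) p≤m²k = colourIndex ∘ colour , colourIndex∘colour-nonrep
  where
  encode : Fin p → Fin m × Fin m × Fin k
  encode i = tripleOf (inject≤ i p≤m²k)

  encode-injective : Injective _≡_ _≡_ encode
  encode-injective = inject≤-injective p≤m²k p≤m²k _ _ ∘ tripleOf-injective

  open Colouring G (encode ∘ φ)

  colourIndex∘colour-nonrep : Nonrepetitive (subdiv3 G) (colourIndex ∘ colour)
  colourIndex∘colour-nonrep xs path =
    colour-nonrepetitive encode∘φ-nonrep xs path ∘ repetitive-∘-injective (subdiv3 G) colourIndex-injective colour xs
    where
    encode∘φ-nonrep : ∀ us → IsPath (toGraph G) us → ¬ Repetitive (toGraph G) (encode ∘ φ) us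
    encode∘φ-nonrep us path′ = φ-nonrep us path′ ∘ repetitive-∘-injective (toGraph G) encode-injective φ us

-- Arithmetic

root-bracket : ∀ n p → ∃[ j ] (j ^ suc n ≤ p × suc p ≤ suc j ^ suc n)
root-bracket n zero = 0 , z≤n , ≤-reflexive (sym (^-zeroˡ (suc n)))
root-bracket n (suc p) with root-bracket n p
... | j , jⁿ≤p , p<[1+j]ⁿ with suc (suc p) ≤? suc j ^ suc n
...   | yes 1+p<[1+j]ⁿ = j , m≤n⇒m≤1+n jⁿ≤p , 1+p<[1+j]ⁿ
...   | no  1+p≮[1+j]ⁿ =
  suc j , <⇒≤pred (≰⇒> 1+p≮[1+j]ⁿ) , ≤-<-trans p<[1+j]ⁿ (^-monoˡ-< (suc n) (n<1+n (suc j)))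

^-distribʳ-* : ∀ m n o → (m * n) ^ o ≡ m ^ o * n ^ o
^-distribʳ-* m n zero    = refl
^-distribʳ-* m n (suc o) = trans (cong (m * n *_) (^-distribʳ-* m n o)) (interchange m n (m ^ o) (n ^ o))
  where
  interchange : ∀ m n a b → m * n * (a * b) ≡ m * a * (n * b)
  interchange = solve-∀

fifth-power : ∀ k → k ^ 5 ≡ k * k * (k * k * k)
fifth-power k = unfolded k
  where
  unfolded : ∀ k → k * (k * (k * (k * (k * 1)))) ≡ k * k * (k * k * k)
  unfolded = solve-∀

four-squares : ∀ k → k * k + (k * k + (k * k + k * k)) ≡ 4 * (k * k)
four-squares = solve-∀

π-subdiv3-bound : ∀ {G p q} k → IsPi (toGraph G) p → IsPi (subdiv3 G) q → p ≤ k ^ 5 → q ≤ 4 * (k * k)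
π-subdiv3-bound {G} {p} {q} k (colouring , _) π₃ p≤k⁵ =
  subst (q ≤_) (four-squares k) (π-minimal (subdiv3 G) π₃ (subdivision-colouring G {m = k * k} {k} colouring p≤m²k))
  where
  p≤m²k : p ≤ k * k * (k * k * k)
  p≤m²k = subst (p ≤_) (fifth-power k) p≤k⁵

-- With j = 8e + 9 + t this is a polynomial identity in e and t with nonnegative coefficients.
square-growth : ∀ e j → 8 * e + 9 ≤ j → suc e * (4 * (suc j * suc j)) ≤ (4 * suc e + 1) * (j * j)
square-growth e j 8e+9≤j with m≤n⇒∃[o]m+o≡n 8e+9≤j
... | t , refl = begin
  suc e * (4 * (suc j * suc j))                                                 ≤⟨ m≤m+n _ _ ⟩
  suc e * (4 * (suc j * suc j)) + (4 * e + 5 + (8 * e + 10) * t + t * t)        ≡⟨ expand e t ⟨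
  (4 * suc e + 1) * (j * j)                                                     ∎
  where
  open ≤-Reasoning
  expand : ∀ e t → (4 * suc e + 1) * ((8 * e + 9 + t) * (8 * e + 9 + t))
                 ≡ suc e * (4 * (suc (8 * e + 9 + t) * suc (8 * e + 9 + t))) + (4 * e + 5 + (8 * e + 10) * t + t * t)
  expand = solve-∀

bound-from-root : ∀ e j p q → 8 * e + 9 ≤ j → j ^ 5 ≤ p → q ≤ 4 * (suc j * suc j) →
                  suc e ^ 5 * q ^ 5 ≤ (4 * suc e + 1) ^ 5 * p ^ 2
bound-from-root e j p q 8e+9≤j j⁵≤p q≤4[1+j]² = begin
  suc e ^ 5 * q ^ 5                                ≤⟨ *-monoʳ-≤ (suc e ^ 5) (^-monoˡ-≤ 5 q≤4[1+j]²) ⟩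
  suc e ^ 5 * (4 * (suc j * suc j)) ^ 5            ≡⟨ ^-distribʳ-* (suc e) (4 * (suc j * suc j)) 5 ⟨
  (suc e * (4 * (suc j * suc j))) ^ 5              ≤⟨ ^-monoˡ-≤ 5 (square-growth e j 8e+9≤j) ⟩
  ((4 * suc e + 1) * (j * j)) ^ 5                  ≡⟨ ^-distribʳ-* (4 * suc e + 1) (j * j) 5 ⟩
  (4 * suc e + 1) ^ 5 * (j * j) ^ 5                ≡⟨ cong ((4 * suc e + 1) ^ 5 *_) (^-distribʳ-* j j 5) ⟩
  (4 * suc e + 1) ^ 5 * (j ^ 5 * j ^ 5)            ≤⟨ *-monoʳ-≤ ((4 * suc e + 1) ^ 5) j¹⁰≤p² ⟩
  (4 * suc e + 1) ^ 5 * p ^ 2                      ∎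
  where
  open ≤-Reasoning
  j¹⁰≤p² : j ^ 5 * j ^ 5 ≤ p ^ 2
  j¹⁰≤p² = *-mono-≤ j⁵≤p (subst (j ^ 5 ≤_) (sym (^-identityʳ p)) j⁵≤p)

lemma88 : (e : ℕ) → ∃[ N ] ((G : FinGraph) (p q : ℕ)
    → IsPi (toGraph G) p → IsPi (subdiv3 G) q → N ≤ p
    → suc e ^ 5 * q ^ 5 ≤ (4 * suc e + 1) ^ 5 * p ^ 2)
lemma88 e = suc ((8 * e + 9) ^ 5) , bound
  where
  bound : (G : FinGraph) (p q : ℕ) → IsPi (toGraph G) p → IsPi (subdiv3 G) q → suc ((8 * e + 9) ^ 5) ≤ p →
          suc e ^ 5 * q ^ 5 ≤ (4 * suc e + 1) ^ 5 * p ^ 2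
  bound G zero    q _  _  ()
  bound G (suc p) q πG π₃ N≤p with root-bracket 4 p
  ... | j , j⁵≤p , p<[1+j]⁵ =
    bound-from-root e j (suc p) q 8e+9≤j (m≤n⇒m≤1+n j⁵≤p) (π-subdiv3-bound (suc j) πG π₃ p<[1+j]⁵)
    where
    8e+9≤j : 8 * e + 9 ≤ j
    8e+9≤j = ≮⇒≥ (λ j<8e+9 → ≤⇒≯ (≤-trans p<[1+j]⁵ (^-monoˡ-≤ 5 j<8e+9)) N≤p)
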